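{- Let $G$ be a tree with root $r$ and $p(r)=0$, and let $T$ be a min-max subtree of $G$. Then for every edge $e$ of $T$, the branch $T_e$ of $T$ rooted at $e$ satisfies $d_G(T_e)\ge d(T)$, with strict inequality whenever $T\neq T_e$.
   Context: $G=(V,E)$ is a tree with edge costs $c(e)>0$, vertex prizes $p(v)\ge0$ and root $r$. For a subgraph $S=(V_S,E_S)$, $p(S)=\sum_{v\in V_S}p(v)$, $c(S)=\sum_{e\in E_S}c(e)$. A rooted subtree is a subtree containing $r$; for one with at least one edge $d(T)=p(T)/c(T)$, and the trivial tree $(\{r\},\emptyset)$ has density $0$. A min-max subtree is an inclusion-wise minimal rooted subtree among the rooted subtrees of maximum density. For an arbitrary subtree $S$ of $G$ with at least one edge, let $r_S$ be the unique vertex of $S$ closest to $r$ in $G$ and define $d_G(S)=(p(S)-p(r_S))/c(S)$. For a subtree $T$ with top vertex $r_T$ (its vertex closest to $r$) and an edge $e$ of $T$, the branch $T_e$ is the subtree of $T$ induced by the endpoints of $e$ and all vertices $u$ of $T$ such that $e$ lies on the $r_T$-$u$ path in $T$.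
   Formalization: The edge costs $c(e)$ and vertex prizes $p(v)$ are rational rather than real. -}

module Defs where

open import Data.Nat using (ℕ; zero; suc)
open import Data.Fin using (Fin; zero; suc; toℕ; _≟_)
open import Data.Bool using (Bool; true; false; if_then_else_; _∨_)
open import Data.Rational using (ℚ; 0ℚ; _+_; _-_; _÷_; _≤_; _<_; ≢-nonZero)
import Data.Rational.Properties as ℚP
open import Data.Product using (_×_; Σ)
open import Relation.Nullary using (yes; no; ¬_)
open import Relation.Nullary.Decidable using (⌊_⌋)
open import Relation.Binary.PropositionalEquality using (_≡_)

-- A rooted tree on the vertex set Fin (suc n), root = zero.
-- Vertex (suc i) has parent (parent i); parents have strictly smaller index,
-- which guarantees acyclicity/connectedness. Edge i (i : Fin n) is the edge
-- between suc i and parent i. Every finite rooted tree is isomorphic to one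
-- in this form (label vertices in BFS order).
record RootedTree (n : ℕ) : Set where
  field
    parent     : Fin n → Fin (suc n)
    parent-lt  : ∀ i → toℕ (parent i) Data.Nat.≤ toℕ i

open RootedTree public

VSet : ℕ → Set
VSet m = Fin m → Bool

_∈_ : ∀ {m} → Fin m → VSet m → Set
v ∈ S = S v ≡ true

_⊆_ : ∀ {m} → VSet m → VSet m → Set
S ⊆ S' = ∀ v → v ∈ S → v ∈ S'

sumFin : ∀ {m} → (Fin m → ℚ) → ℚ
sumFin {zero}  f = 0ℚ
sumFin {suc m} f = f zero + sumFin (λ i → f (suc i))

-- In a tree, a subtree is determined by its vertex set (its edges are all
-- tree edges between its vertices).  Edge i lies in the subtree S iff both
-- endpoints suc i and parent i are in S.
edgeIn : ∀ {n} → RootedTree n → VSet (suc n) → Fin n → Bool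
edgeIn G S i = if S (suc i) then S (parent G i) else false

prize : ∀ {n} → (Fin (suc n) → ℚ) → VSet (suc n) → ℚ
prize p S = sumFin (λ v → if S v then p v else 0ℚ)

cost : ∀ {n} → RootedTree n → (Fin n → ℚ) → VSet (suc n) → ℚ
cost G c S = sumFin (λ i → if edgeIn G S i then c i else 0ℚ)

-- (num) / (cost), defined as 0 when the cost is 0 (i.e. no edges,
-- since all edge costs are positive)
ratio : ℚ → ℚ → ℚ
ratio num den with den ℚP.≟ 0ℚ
... | yes _  = 0ℚ
... | no ne  = _÷_ num den {{≢-nonZero ne}}

-- rooted subtree: contains the root and is closed under taking parents
-- (equivalently: a connected subgraph containing r)
IsRootedSubtree : ∀ {n} → RootedTree n → VSet (suc n) → Set
IsRootedSubtree G T = (zero ∈ T) × (∀ i → suc i ∈ T → parent G i ∈ T)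

density : ∀ {n} → RootedTree n → (Fin (suc n) → ℚ) → (Fin n → ℚ) → VSet (suc n) → ℚ
density G p c T = ratio (prize p T) (cost G c T)

IsMaxDensity : ∀ {n} → RootedTree n → (Fin (suc n) → ℚ) → (Fin n → ℚ) → VSet (suc n) → Set
IsMaxDensity G p c T =
  IsRootedSubtree G T ×
  (∀ T' → IsRootedSubtree G T' → density G p c T' ≤ density G p c T)

IsMinMax : ∀ {n} → RootedTree n → (Fin (suc n) → ℚ) → (Fin n → ℚ) → VSet (suc n) → Set
IsMinMax G p c T =
  IsMaxDensity G p c T ×
  (∀ T' → IsMaxDensity G p c T' → T' ⊆ T → T ⊆ T')

-- isDesc G k v w : w is reachable from v by going down, i.e. v lies on the
-- root-w path (w = v allowed); fuel k bounds the number of parent steps.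
isDescFuel : ∀ {n} → RootedTree n → ℕ → Fin (suc n) → Fin (suc n) → Bool
isDescFuel G k v zero with v ≟ zero
... | yes _ = true
... | no  _ = false
isDescFuel G zero v (suc j) = ⌊ v ≟ suc j ⌋
isDescFuel G (suc k) v (suc j) = ⌊ v ≟ suc j ⌋ ∨ isDescFuel G k v (parent G j)

-- fuel n suffices: each parent step decreases the index by at least one
isDesc : ∀ {n} → RootedTree n → Fin (suc n) → Fin (suc n) → Bool
isDesc {n} G = isDescFuel G n

-- Branch T_e for the edge e = {suc i, parent i} of the rooted subtree T
-- (top vertex r_T = r): the endpoints of e together with all vertices u of T
-- such that e lies on the r-u path in T, i.e. u is (weakly) below suc i.
branch : ∀ {n} → RootedTree n → VSet (suc n) → Fin n → VSet (suc n)
branch G T i u = ⌊ u ≟ parent G i ⌋ ∨ (if T u then isDesc G (suc i) u else false)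

-- d_G(S) = (p(S) - p(r_S)) / c(S), for S = T_e, whose top vertex r_S is parent i
densityG-branch : ∀ {n} → RootedTree n → (Fin (suc n) → ℚ) → (Fin n → ℚ)
                  → VSet (suc n) → Fin n → ℚ
densityG-branch G p c T i =
  ratio (prize p (branch G T i) - p (parent G i)) (cost G c (branch G T i))

-- Cut T at the edge e = {a, suc i}, a = parent i. The trunk (T without the vertices below suc i)
-- and the branch Tₑ share the vertex a and no edge, so
--   p(T) = p(trunk) + (p(Tₑ) - p(a))   and   c(T) = c(trunk) + c(Tₑ),
-- i.e. d(T) is a mediant of d(trunk) and d_G(Tₑ). The trunk is a rooted subtree, so d(trunk) ≤ d(T).
-- If the trunk has an edge, equality would make it a smaller maximum-density rooted subtree, so
-- d(trunk) < d(T) and hence d(T) < d_G(Tₑ). Otherwise the trunk is {r}: then a = r, p(a) = 0 and T = Tₑ.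
module Submission where

open import Defs
open import Data.Nat using (ℕ; zero; suc)
open import Data.Fin using (Fin; zero; suc)
open import Data.Bool using (Bool; true; false)
open import Data.Rational using (ℚ; 0ℚ; _≤_; _<_)
open import Data.Product using (_×_)
open import Relation.Nullary using (¬_)
open import Relation.Binary.PropositionalEquality using (_≡_)

import Data.Nat as ℕ
import Data.Nat.Properties as ℕ
open import Data.Fin using (toℕ; _≟_)
open import Data.Fin.Properties using (toℕ≤pred[n]; suc-injective)
open import Data.Bool using (if_then_else_; _∨_; _∧_; not)
open import Data.Bool.Properties
  using (∨-identityʳ; ∧-identityʳ; ∧-zeroʳ; ∨-conicalʳ; ∧-conicalˡ; ∧-conicalʳ; not-injective)
open import Data.Rational using (_+_; _*_; _-_; -_; positive; nonNegative; ≢-nonZero)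
open import Data.Rational.Properties
  using ( ≤-refl; ≤-reflexive; <⇒≤; <-irrefl; <-≤-trans; <-cmp; ≰⇒>
        ; +-assoc; +-identityˡ; +-identityʳ; +-inverseʳ; *-assoc; *-identityʳ; *-inverseˡ
        ; *-distribˡ-+; +-mono-≤; +-mono-<; +-mono-<-≤
        ; *-monoˡ-<-pos; *-monoʳ-≤-nonNeg; +-0-commutativeMonoid)
  renaming (_≟_ to _≟ℚ_)
open import Data.Product using (_,_; proj₁; proj₂)
open import Data.Sum using (_⊎_; inj₁; inj₂)
open import Data.Empty using (⊥-elim)
open import Function using (_∘_; case_of_)
open import Relation.Nullary using (yes; no)
open import Relation.Nullary.Decidable using (⌊_⌋; ⌊⌋-map′; isYes≗does; dec-true; dec-false)
open import Relation.Binary.Definitions using (tri<; tri≈; tri>)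
open import Algebra.Bundles using (CommutativeMonoid)
open import Algebra.Properties.CommutativeSemigroup
  (CommutativeMonoid.commutativeSemigroup +-0-commutativeMonoid)
  using () renaming (interchange to +-interchange)
open import Relation.Binary.PropositionalEquality
  using (_≢_; refl; sym; trans; cong; cong₂; subst; module ≡-Reasoning)

≤⇒<⊎≡ : ∀ {x y : ℚ} → x ≤ y → x < y ⊎ x ≡ y
≤⇒<⊎≡ {x} {y} x≤y with <-cmp x y
... | tri< x<y _ _ = inj₁ x<y
... | tri≈ _ x≡y _ = inj₂ x≡y
... | tri> _ _ x>y = ⊥-elim (<-irrefl refl (<-≤-trans x>y x≤y))

x+y≡w+z⇒x+[y-z]≡w : ∀ {x y z w : ℚ} → x + y ≡ w + z → x + (y - z) ≡ w
x+y≡w+z⇒x+[y-z]≡w {x} {y} {z} {w} x+y≡w+z = begin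
  x + (y - z)   ≡⟨ +-assoc x y (- z) ⟨
  (x + y) - z   ≡⟨ cong (_- z) x+y≡w+z ⟩
  (w + z) - z   ≡⟨ +-assoc w z (- z) ⟩
  w + (z - z)   ≡⟨ cong (w +_) (+-inverseʳ z) ⟩
  w + 0ℚ        ≡⟨ +-identityʳ w ⟩
  w             ∎
  where open ≡-Reasoning

ratio-* : ∀ x {y} → 0ℚ < y → ratio x y * y ≡ x
ratio-* x {y} y>0 with y ≟ℚ 0ℚ
... | yes y≡0 = ⊥-elim (<-irrefl (sym y≡0) y>0)
... | no y≢0 =
  trans (*-assoc x _ y) (trans (cong (x *_) (*-inverseˡ y {{≢-nonZero y≢0}})) (*-identityʳ x))

module _ {P₁ P₂ P C₁ C₂ C : ℚ} (C₁>0 : 0ℚ < C₁) (C₂>0 : 0ℚ < C₂)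
         (P₁+P₂≡P : P₁ + P₂ ≡ P) (C₁+C₂≡C : C₁ + C₂ ≡ C) where

  private
    C>0 : 0ℚ < C
    C>0 = subst (0ℚ <_) C₁+C₂≡C (+-mono-< C₁>0 C₂>0)

    weighted-sum : ratio P₁ C₁ * C₁ + ratio P₂ C₂ * C₂ ≡ ratio P C * C₁ + ratio P C * C₂
    weighted-sum = begin
      ratio P₁ C₁ * C₁ + ratio P₂ C₂ * C₂   ≡⟨ cong₂ _+_ (ratio-* P₁ C₁>0) (ratio-* P₂ C₂>0) ⟩
      P₁ + P₂                               ≡⟨ P₁+P₂≡P ⟩
      P                                     ≡⟨ ratio-* P C>0 ⟨
      ratio P C * C                         ≡⟨ cong (ratio P C *_) C₁+C₂≡C ⟨
      ratio P C * (C₁ + C₂)                 ≡⟨ *-distribˡ-+ (ratio P C) C₁ C₂ ⟩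
      ratio P C * C₁ + ratio P C * C₂       ∎
      where open ≡-Reasoning

  mediant-< : ratio P₁ C₁ < ratio P C → ratio P C < ratio P₂ C₂
  mediant-< f<d = ≰⇒> λ e≤d → <-irrefl weighted-sum
    (+-mono-<-≤ (*-monoˡ-<-pos C₁ {{positive C₁>0}} f<d)
                (*-monoʳ-≤-nonNeg C₂ {{nonNegative (<⇒≤ C₂>0)}} e≤d))

sumFin-cong : ∀ {m} {f g : Fin m → ℚ} → (∀ v → f v ≡ g v) → sumFin f ≡ sumFin g
sumFin-cong {zero}  f≗g = refl
sumFin-cong {suc m} f≗g = cong₂ _+_ (f≗g zero) (sumFin-cong (λ v → f≗g (suc v)))

sumFin-0 : ∀ {m} → sumFin {m} (λ _ → 0ℚ) ≡ 0ℚ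
sumFin-0 {zero}  = refl
sumFin-0 {suc m} = trans (+-identityˡ _) (sumFin-0 {m})

sumFin-+ : ∀ {m} (f g : Fin m → ℚ) → sumFin (λ v → f v + g v) ≡ sumFin f + sumFin g
sumFin-+ {zero}  f g = sym (+-identityˡ 0ℚ)
sumFin-+ {suc m} f g =
  trans (cong (f zero + g zero +_) (sumFin-+ (λ v → f (suc v)) (λ v → g (suc v))))
        (+-interchange (f zero) (g zero) _ _)

sumFin-nonneg : ∀ {m} {f : Fin m → ℚ} → (∀ v → 0ℚ ≤ f v) → 0ℚ ≤ sumFin f
sumFin-nonneg {zero}  f≥0 = ≤-refl
sumFin-nonneg {suc m} f≥0 = +-mono-≤ (f≥0 zero) (sumFin-nonneg (λ v → f≥0 (suc v)))

sumFin-≥ : ∀ {m} {f : Fin m → ℚ} → (∀ v → 0ℚ ≤ f v) → ∀ v → f v ≤ sumFin f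
sumFin-≥ {suc m} {f} f≥0 zero = subst (_≤ sumFin f) (+-identityʳ (f zero))
  (+-mono-≤ (≤-refl {f zero}) (sumFin-nonneg (λ v → f≥0 (suc v))))
sumFin-≥ {suc m} {f} f≥0 (suc v) = subst (_≤ sumFin f) (+-identityˡ (f (suc v)))
  (+-mono-≤ (f≥0 zero) (sumFin-≥ (λ v → f≥0 (suc v)) v))

sumOn : ∀ {m} → (Fin m → ℚ) → VSet m → ℚ
sumOn f S = sumFin (λ v → if S v then f v else 0ℚ)

sumOn-cong : ∀ {m} (f : Fin m → ℚ) {S S′ : VSet m} → (∀ v → S v ≡ S′ v) → sumOn f S ≡ sumOn f S′
sumOn-cong f S≗S′ = sumFin-cong (λ v → cong (if_then f v else 0ℚ) (S≗S′ v))

sumOn-singleton : ∀ {m} (f : Fin m → ℚ) (a : Fin m) → sumOn f (λ v → ⌊ v ≟ a ⌋) ≡ f a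
sumOn-singleton {suc m} f zero    = trans (cong (f zero +_) (sumFin-0 {m})) (+-identityʳ (f zero))
sumOn-singleton {suc m} f (suc a) = begin
  0ℚ + sumOn (λ v → f (suc v)) (λ v → ⌊ suc v ≟ suc a ⌋)
    ≡⟨ +-identityˡ _ ⟩
  sumOn (λ v → f (suc v)) (λ v → ⌊ suc v ≟ suc a ⌋)
    ≡⟨ sumOn-cong (λ v → f (suc v)) (λ v → ⌊⌋-map′ _ _ (v ≟ a)) ⟩
  sumOn (λ v → f (suc v)) (λ v → ⌊ v ≟ a ⌋)
    ≡⟨ sumOn-singleton (λ v → f (suc v)) a ⟩
  f (suc a)
    ∎
  where open ≡-Reasoning

sumOn-∪-∩ : ∀ {m} (f : Fin m → ℚ) (S S′ : VSet m)
  → sumOn f (λ v → S v ∨ S′ v) + sumOn f (λ v → S v ∧ S′ v) ≡ sumOn f S + sumOn f S′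
sumOn-∪-∩ f S S′ = begin
  sumOn f (λ v → S v ∨ S′ v) + sumOn f (λ v → S v ∧ S′ v)
    ≡⟨ sumFin-+ (λ v → 𝟙 (S v ∨ S′ v) v) (λ v → 𝟙 (S v ∧ S′ v) v) ⟨
  sumFin (λ v → 𝟙 (S v ∨ S′ v) v + 𝟙 (S v ∧ S′ v) v)
    ≡⟨ sumFin-cong (λ v → pointwise (S v) (S′ v) v) ⟩
  sumFin (λ v → 𝟙 (S v) v + 𝟙 (S′ v) v)
    ≡⟨ sumFin-+ (λ v → 𝟙 (S v) v) (λ v → 𝟙 (S′ v) v) ⟩
  sumOn f S + sumOn f S′
    ∎
  where
  open ≡-Reasoning
  𝟙 : Bool → _ → ℚ
  𝟙 b v = if b then f v else 0ℚ
  pointwise : ∀ s s′ v → 𝟙 (s ∨ s′) v + 𝟙 (s ∧ s′) v ≡ 𝟙 s v + 𝟙 s′ v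
  pointwise false false v = refl
  pointwise false true  v = trans (+-identityʳ (f v)) (sym (+-identityˡ (f v)))
  pointwise true  false v = refl
  pointwise true  true  v = refl

if-then-else-0-nonneg : ∀ b {x} → 0ℚ ≤ x → 0ℚ ≤ (if b then x else 0ℚ)
if-then-else-0-nonneg true  x≥0 = x≥0
if-then-else-0-nonneg false x≥0 = ≤-refl

sumOn-nonneg : ∀ {m} {f : Fin m → ℚ} → (∀ v → 0ℚ ≤ f v) → ∀ S → 0ℚ ≤ sumOn f S
sumOn-nonneg f≥0 S = sumFin-nonneg (λ v → if-then-else-0-nonneg (S v) (f≥0 v))

sumOn-≥ : ∀ {m} {f : Fin m → ℚ} {S : VSet m} → (∀ v → 0ℚ ≤ f v)
  → ∀ {v} → v ∈ S → f v ≤ sumOn f S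
sumOn-≥ {f = f} {S} f≥0 {v} v∈S = subst (λ b → (if b then f v else 0ℚ) ≤ sumOn f S) v∈S
  (sumFin-≥ (λ u → if-then-else-0-nonneg (S u) (f≥0 u)) v)

⌊≟⌋-refl : ∀ {m} (a : Fin m) → ⌊ a ≟ a ⌋ ≡ true
⌊≟⌋-refl a = trans (isYes≗does (a ≟ a)) (dec-true (a ≟ a) refl)

⌊≟⌋-≢ : ∀ {m} {u a : Fin m} → u ≢ a → ⌊ u ≟ a ⌋ ≡ false
⌊≟⌋-≢ {u = u} {a} u≢a = trans (isYes≗does (u ≟ a)) (dec-false (u ≟ a) u≢a)

if-then-else-false : ∀ b {x} → (if b then x else false) ≡ b ∧ x
if-then-else-false true  = refl
if-then-else-false false = refl

Partition : Bool → Bool → Bool → Set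
Partition x y z = (x ≡ false × y ≡ z) ⊎ (x ≡ z × y ≡ false)

Partition-∨ : ∀ {x y z} → Partition x y z → x ∨ y ≡ z
Partition-∨ (inj₁ (refl , refl)) = refl
Partition-∨ (inj₂ (refl , refl)) = ∨-identityʳ _

Partition-∧ : ∀ {x y z} → Partition x y z → x ∧ y ≡ false
Partition-∧ (inj₁ (refl , _)) = refl
Partition-∧ (inj₂ (_ , refl)) = ∧-zeroʳ _

∧-not-partition : ∀ t d → Partition (t ∧ not d) (t ∧ d) t
∧-not-partition true  true  = inj₁ (refl , refl)
∧-not-partition true  false = inj₂ (refl , refl)
∧-not-partition false d     = inj₁ (refl , refl)

x⇒y⇒x∨y≡y : ∀ x {y} → (x ≡ true → y ≡ true) → x ∨ y ≡ y
x⇒y⇒x∨y≡y true  x⇒y = sym (x⇒y refl)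
x⇒y⇒x∨y≡y false x⇒y = refl

module _ {n} (G : RootedTree n) where

  parent-< : ∀ j → toℕ (parent G j) ℕ.< toℕ (suc j)
  parent-< j = ℕ.s≤s (parent-lt G j)

  parent≢suc : ∀ j → parent G j ≢ suc j
  parent≢suc j p≡s = ℕ.<-irrefl (cong toℕ p≡s) (parent-< j)

  parent≤pred[n] : ∀ j → toℕ (parent G j) ℕ.≤ ℕ.pred n
  parent≤pred[n] j = ℕ.≤-trans (parent-lt G j) (toℕ≤pred[n] j)

  isDescFuel-saturated : ∀ k v w → toℕ w ℕ.≤ k → isDescFuel G k v w ≡ isDescFuel G (suc k) v w
  isDescFuel-saturated k       v zero    _          = refl
  isDescFuel-saturated (suc k) v (suc j) (ℕ.s≤s j≤k) =
    cong (⌊ v ≟ suc j ⌋ ∨_) (isDescFuel-saturated k v (parent G j) (ℕ.≤-trans (parent-lt G j) j≤k))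

  isDescFuel⇒≤ : ∀ k v w → isDescFuel G k v w ≡ true → toℕ v ℕ.≤ toℕ w
  isDescFuel⇒≤ k       v zero    desc with v ≟ zero
  ... | yes refl = ℕ.≤-refl
  isDescFuel⇒≤ zero    v (suc j) desc with v ≟ suc j
  ... | yes refl = ℕ.≤-refl
  isDescFuel⇒≤ (suc k) v (suc j) desc with v ≟ suc j
  ... | yes refl = ℕ.≤-refl
  ... | no _     = ℕ.<⇒≤ (ℕ.≤-<-trans (isDescFuel⇒≤ k v (parent G j) desc) (parent-< j))

  isDesc⇒≤ : ∀ {v w} → isDesc G v w ≡ true → toℕ v ℕ.≤ toℕ w
  isDesc⇒≤ = isDescFuel⇒≤ n _ _

  isDesc-refl : ∀ v → isDesc G v v ≡ true
  isDesc-refl zero            = refl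
  isDesc-refl (suc {suc k} j) = cong (_∨ isDescFuel G k (suc j) (parent G j)) (⌊≟⌋-refl (suc j))

  isDesc-suc : ∀ v j → isDesc G v (suc j) ≡ ⌊ v ≟ suc j ⌋ ∨ isDesc G v (parent G j)
  -- Matching on j only exposes n = suc _, so that isDesc unfolds one step.
  isDesc-suc v j@zero    = cong (⌊ v ≟ suc j ⌋ ∨_) (isDescFuel-saturated _ v (parent G j) (parent≤pred[n] j))
  isDesc-suc v j@(suc _) = cong (⌊ v ≟ suc j ⌋ ∨_) (isDescFuel-saturated _ v (parent G j) (parent≤pred[n] j))

  edgeIn-cong : ∀ (S S′ : VSet (suc n)) j → S (suc j) ≡ S′ (suc j) → S (parent G j) ≡ S′ (parent G j)
    → edgeIn G S j ≡ edgeIn G S′ j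
  edgeIn-cong S S′ j = cong₂ (λ s t → if s then t else false)

  edgeIn-lower-∉ : ∀ (S : VSet (suc n)) j → S (suc j) ≡ false → edgeIn G S j ≡ false
  edgeIn-lower-∉ S j = cong (λ s → if s then S (parent G j) else false)

  edgeIn-endpoints : ∀ (S : VSet (suc n)) j → edgeIn G S j ≡ true → suc j ∈ S × parent G j ∈ S
  edgeIn-endpoints S j e with S (suc j)
  ... | true = refl , e

  edgeIn-intro : ∀ (S : VSet (suc n)) j → suc j ∈ S → parent G j ∈ S → edgeIn G S j ≡ true
  edgeIn-intro S j sj∈S pj∈S rewrite sj∈S = pj∈S

  edgeIn-rooted : ∀ (S : VSet (suc n)) → IsRootedSubtree G S → ∀ {j} → suc j ∈ S → edgeIn G S j ≡ true
  edgeIn-rooted S (_ , closed) {j} sj∈S = edgeIn-intro S j sj∈S (closed j sj∈S)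

  edgeIn-singleton : ∀ v j → edgeIn G (λ u → ⌊ u ≟ v ⌋) j ≡ false
  edgeIn-singleton v j with suc j ≟ v
  ... | yes refl = ⌊≟⌋-≢ (parent≢suc j)
  ... | no _     = refl

  module _ (c : Fin n → ℚ) (c>0 : ∀ j → 0ℚ < c j) where

    cost-nonneg : ∀ S → 0ℚ ≤ cost G c S
    cost-nonneg S = sumOn-nonneg (λ j → <⇒≤ (c>0 j)) (edgeIn G S)

    cost-pos : ∀ {S j} → edgeIn G S j ≡ true → 0ℚ < cost G c S
    cost-pos {j = j} e = <-≤-trans (c>0 j) (sumOn-≥ (λ j → <⇒≤ (c>0 j)) e)

    costless-rooted⇒root : ∀ {S} → IsRootedSubtree G S → cost G c S ≡ 0ℚ → ∀ v → v ∈ S → v ≡ zero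
    costless-rooted⇒root     S-rooted C≡0 zero    _    = refl
    costless-rooted⇒root {S} S-rooted C≡0 (suc j) sj∈S =
      ⊥-elim (<-irrefl (sym C≡0) (cost-pos {S} (edgeIn-rooted S S-rooted sj∈S)))

module BranchDecomposition {n} (G : RootedTree n) (T : VSet (suc n)) (i : Fin n) (i∈T : edgeIn G T i ≡ true) where

  a : Fin (suc n)
  a = parent G i

  below : VSet (suc n)
  below = isDesc G (suc i)

  trunk : VSet (suc n)
  trunk u = T u ∧ not (below u)

  Tₑ : VSet (suc n)
  Tₑ = branch G T i

  suc-i∈T : suc i ∈ T
  suc-i∈T = proj₁ (edgeIn-endpoints G T i i∈T)

  a∈T : a ∈ T
  a∈T = proj₂ (edgeIn-endpoints G T i i∈T)

  suc-i-below : below (suc i) ≡ true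
  suc-i-below = isDesc-refl G (suc i)

  a-not-below : below a ≡ false
  a-not-below with below a in a-below
  ... | true  = ⊥-elim (ℕ.<⇒≱ (parent-< G i) (isDesc⇒≤ G a-below))
  ... | false = refl

  below-suc : ∀ j → j ≢ i → below (suc j) ≡ below (parent G j)
  below-suc j j≢i =
    trans (isDesc-suc G (suc i) j) (cong (_∨ below (parent G j)) (⌊≟⌋-≢ (j≢i ∘ sym ∘ suc-injective)))

  below-parent : ∀ j → below (suc j) ≡ false → below (parent G j) ≡ false
  below-parent j sj-not-below = ∨-conicalʳ _ _ (trans (sym (isDesc-suc G (suc i) j)) sj-not-below)

  Tₑ≡ : ∀ u → Tₑ u ≡ ⌊ u ≟ a ⌋ ∨ (T u ∧ below u)
  Tₑ≡ u = cong (⌊ u ≟ a ⌋ ∨_) (if-then-else-false (T u))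

  trunk-below : ∀ {u} → below u ≡ true → trunk u ≡ false
  trunk-below {u} u-below = trans (cong (λ d → T u ∧ not d) u-below) (∧-zeroʳ (T u))

  trunk-not-below : ∀ {u} → below u ≡ false → trunk u ≡ T u
  trunk-not-below {u} u-not-below = trans (cong (λ d → T u ∧ not d) u-not-below) (∧-identityʳ (T u))

  Tₑ-off-a : ∀ {u} → u ≢ a → Tₑ u ≡ T u ∧ below u
  Tₑ-off-a {u} u≢a = trans (Tₑ≡ u) (cong (_∨ (T u ∧ below u)) (⌊≟⌋-≢ u≢a))

  Tₑ-below : ∀ {u} → below u ≡ true → Tₑ u ≡ T u
  Tₑ-below {u} u-below = trans (Tₑ-off-a u≢a) (trans (cong (T u ∧_) u-below) (∧-identityʳ (T u)))
    where
    u≢a : u ≢ a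
    u≢a refl with () ← trans (sym u-below) a-not-below

  Tₑ-not-below : ∀ {u} → below u ≡ false → Tₑ u ≡ ⌊ u ≟ a ⌋
  Tₑ-not-below {u} u-not-below = begin
    Tₑ u                         ≡⟨ Tₑ≡ u ⟩
    ⌊ u ≟ a ⌋ ∨ (T u ∧ below u)  ≡⟨ cong (λ d → ⌊ u ≟ a ⌋ ∨ (T u ∧ d)) u-not-below ⟩
    ⌊ u ≟ a ⌋ ∨ (T u ∧ false)    ≡⟨ cong (⌊ u ≟ a ⌋ ∨_) (∧-zeroʳ (T u)) ⟩
    ⌊ u ≟ a ⌋ ∨ false            ≡⟨ ∨-identityʳ _ ⟩
    ⌊ u ≟ a ⌋                    ∎
    where open ≡-Reasoning

  a∈trunk : a ∈ trunk
  a∈trunk = trans (trunk-not-below a-not-below) a∈T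

  a∈Tₑ : a ∈ Tₑ
  a∈Tₑ = cong (_∨ (if T a then below a else false)) (⌊≟⌋-refl a)

  suc-i∉trunk : ¬ suc i ∈ trunk
  suc-i∉trunk si∈trunk with () ← trans (sym (trunk-below suc-i-below)) si∈trunk

  i∈Tₑ : edgeIn G Tₑ i ≡ true
  i∈Tₑ = edgeIn-intro G Tₑ i (trans (Tₑ-below suc-i-below) suc-i∈T) a∈Tₑ

  trunk-∪-Tₑ : ∀ u → trunk u ∨ Tₑ u ≡ T u
  trunk-∪-Tₑ u = case u ≟ a of λ where
    (yes refl) → trans (cong₂ _∨_ a∈trunk a∈Tₑ) (sym a∈T)
    (no u≢a)   → trans (cong (trunk u ∨_) (Tₑ-off-a u≢a)) (Partition-∨ (∧-not-partition (T u) (below u)))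

  trunk-∩-Tₑ : ∀ u → trunk u ∧ Tₑ u ≡ ⌊ u ≟ a ⌋
  trunk-∩-Tₑ u = case u ≟ a of λ where
    (yes refl) → trans (cong₂ _∧_ a∈trunk a∈Tₑ) (sym (⌊≟⌋-refl a))
    (no u≢a)   → trans (cong (trunk u ∧_) (Tₑ-off-a u≢a))
                       (trans (Partition-∧ (∧-not-partition (T u) (below u))) (sym (⌊≟⌋-≢ u≢a)))

  edge-partition-off-i : ∀ {j} → j ≢ i → ∀ {b} → below (parent G j) ≡ b
    → Partition (edgeIn G trunk j) (edgeIn G Tₑ j) (edgeIn G T j)
  edge-partition-off-i {j} j≢i {true} pj-below = inj₁
    ( edgeIn-lower-∉ G trunk j (trunk-below sj-below)
    , edgeIn-cong G Tₑ T j (Tₑ-below sj-below) (Tₑ-below pj-below))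
    where sj-below = trans (below-suc j j≢i) pj-below
  edge-partition-off-i {j} j≢i {false} pj-below = inj₂
    ( edgeIn-cong G trunk T j (trunk-not-below sj-not-below) (trunk-not-below pj-below)
    , trans (edgeIn-cong G Tₑ (λ u → ⌊ u ≟ a ⌋) j (Tₑ-not-below sj-not-below) (Tₑ-not-below pj-below))
            (edgeIn-singleton G a j))
    where sj-not-below = trans (below-suc j j≢i) pj-below

  edge-partition : ∀ j → Partition (edgeIn G trunk j) (edgeIn G Tₑ j) (edgeIn G T j)
  edge-partition j = case j ≟ i of λ where
    (yes refl) → inj₁ (edgeIn-lower-∉ G trunk i (trunk-below suc-i-below) , trans i∈Tₑ (sym i∈T))
    (no j≢i)   → edge-partition-off-i j≢i refl

  trunk-rooted : IsRootedSubtree G T → IsRootedSubtree G trunk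
  trunk-rooted (root∈T , T-closed) = trans (trunk-not-below refl) root∈T , trunk-closed
    where
    trunk-closed : ∀ j → suc j ∈ trunk → parent G j ∈ trunk
    trunk-closed j sj∈trunk = trans (trunk-not-below (below-parent j sj-not-below)) (T-closed j sj∈T)
      where
      sj∈T = ∧-conicalˡ _ _ sj∈trunk
      sj-not-below = not-injective (∧-conicalʳ _ _ sj∈trunk)

  trunk⊆T : trunk ⊆ T
  trunk⊆T u = ∧-conicalˡ _ _

  prize-split : ∀ (p : Fin (suc n) → ℚ) → prize p trunk + prize p Tₑ ≡ prize p T + p a
  prize-split p = begin
    sumOn p trunk + sumOn p Tₑ
      ≡⟨ sumOn-∪-∩ p trunk Tₑ ⟨
    sumOn p (λ u → trunk u ∨ Tₑ u) + sumOn p (λ u → trunk u ∧ Tₑ u)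
      ≡⟨ cong₂ _+_ (sumOn-cong p trunk-∪-Tₑ) (sumOn-cong p trunk-∩-Tₑ) ⟩
    sumOn p T + sumOn p (λ u → ⌊ u ≟ a ⌋)
      ≡⟨ cong (sumOn p T +_) (sumOn-singleton p a) ⟩
    sumOn p T + p a
      ∎
    where open ≡-Reasoning

  cost-split : ∀ (c : Fin n → ℚ) → cost G c trunk + cost G c Tₑ ≡ cost G c T
  cost-split c = begin
    sumOn c (edgeIn G trunk) + sumOn c (edgeIn G Tₑ)
      ≡⟨ sumOn-∪-∩ c (edgeIn G trunk) (edgeIn G Tₑ) ⟨
    sumOn c (λ j → edgeIn G trunk j ∨ edgeIn G Tₑ j) + sumOn c (λ j → edgeIn G trunk j ∧ edgeIn G Tₑ j)
      ≡⟨ cong₂ _+_ (sumOn-cong c (Partition-∨ ∘ edge-partition)) (sumOn-cong c (Partition-∧ ∘ edge-partition)) ⟩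
    sumOn c (edgeIn G T) + sumOn c (λ _ → false)
      ≡⟨ cong (sumOn c (edgeIn G T) +_) (sumFin-0 {n}) ⟩
    sumOn c (edgeIn G T) + 0ℚ
      ≡⟨ +-identityʳ _ ⟩
    sumOn c (edgeIn G T)
      ∎
    where open ≡-Reasoning

module _ {n} (G : RootedTree n) (p : Fin (suc n) → ℚ) (c : Fin n → ℚ) (c>0 : ∀ j → 0ℚ < c j)
         (T : VSet (suc n)) (i : Fin n) (i∈T : edgeIn G T i ≡ true) where

  open BranchDecomposition G T i i∈T

  nontrivial-trunk⇒branch-denser : IsMinMax G p c T → 0ℚ < cost G c trunk
    → density G p c T < densityG-branch G p c T i
  nontrivial-trunk⇒branch-denser ((T-rooted , T-max) , T-minimal) trunk-cost>0
    with ≤⇒<⊎≡ (T-max trunk (trunk-rooted T-rooted))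
  ... | inj₁ d[trunk]<d[T] = mediant-< trunk-cost>0 (cost-pos G c c>0 {Tₑ} i∈Tₑ)
          (x+y≡w+z⇒x+[y-z]≡w {prize p trunk} {prize p Tₑ} (prize-split p)) (cost-split c) d[trunk]<d[T]
  ... | inj₂ d[trunk]≡d[T] = ⊥-elim (suc-i∉trunk (T-minimal trunk trunk-max trunk⊆T (suc i) suc-i∈T))
    where
    trunk-max : IsMaxDensity G p c trunk
    trunk-max = trunk-rooted T-rooted , λ T′ T′-rooted →
      subst (density G p c T′ ≤_) (sym d[trunk]≡d[T]) (T-max T′ T′-rooted)

  trivial-trunk⇒T≡branch : p zero ≡ 0ℚ → IsRootedSubtree G T → cost G c trunk ≡ 0ℚ
    → (∀ u → T u ≡ Tₑ u) × density G p c T ≡ densityG-branch G p c T i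
  trivial-trunk⇒T≡branch p₀ T-rooted trunk-costless = T≗Tₑ , cong₂ ratio prize≡ cost≡
    where
    trunk⊆root : ∀ u → u ∈ trunk → u ≡ zero
    trunk⊆root = costless-rooted⇒root G c c>0 (trunk-rooted T-rooted) trunk-costless

    trunk⊆Tₑ : trunk ⊆ Tₑ
    trunk⊆Tₑ u u∈trunk =
      subst (_∈ Tₑ) (trans (trunk⊆root a a∈trunk) (sym (trunk⊆root u u∈trunk))) a∈Tₑ

    T≗Tₑ : ∀ u → T u ≡ Tₑ u
    T≗Tₑ u = trans (sym (trunk-∪-Tₑ u)) (x⇒y⇒x∨y≡y (trunk u) (trunk⊆Tₑ u))

    prize≡ : prize p T ≡ prize p Tₑ - p a
    prize≡ = begin
      prize p T         ≡⟨ sumOn-cong p T≗Tₑ ⟩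
      prize p Tₑ        ≡⟨ +-identityʳ (prize p Tₑ) ⟨
      prize p Tₑ - 0ℚ   ≡⟨ cong (λ x → prize p Tₑ - x) (trans (cong p (trunk⊆root a a∈trunk)) p₀) ⟨
      prize p Tₑ - p a  ∎
      where open ≡-Reasoning

    cost≡ : cost G c T ≡ cost G c Tₑ
    cost≡ = sumOn-cong c (λ j → edgeIn-cong G T Tₑ j (T≗Tₑ (suc j)) (T≗Tₑ (parent G j)))

lemma8 : ∀ {n} (G : RootedTree n) (p : Fin (suc n) → ℚ) (c : Fin n → ℚ)
    → (∀ i → 0ℚ < c i) → (∀ v → 0ℚ ≤ p v) → p zero ≡ 0ℚ
    → (T : VSet (suc n)) → IsMinMax G p c T
    → ∀ (i : Fin n) → edgeIn G T i ≡ true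
    → (density G p c T ≤ densityG-branch G p c T i)
    × (¬ (∀ u → T u ≡ branch G T i u) → density G p c T < densityG-branch G p c T i)
lemma8 G p c c>0 _ p₀ T T-minmax i i∈T
  with ≤⇒<⊎≡ (cost-nonneg G c c>0 (BranchDecomposition.trunk G T i i∈T))
... | inj₁ trunk-cost>0 = <⇒≤ d[T]<d[Tₑ] , λ _ → d[T]<d[Tₑ]
  where d[T]<d[Tₑ] = nontrivial-trunk⇒branch-denser G p c c>0 T i i∈T T-minmax trunk-cost>0
... | inj₂ 0≡trunk-cost = ≤-reflexive (proj₂ T≡Tₑ) , λ T≢Tₑ → ⊥-elim (T≢Tₑ (proj₁ T≡Tₑ))
  where T≡Tₑ = trivial-trunk⇒T≡branch G p c c>0 T i i∈T p₀ (proj₁ (proj₁ T-minmax)) (sym 0≡trunk-cost)
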